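{- Let $S+1=\{n^2+1: n\in\mathbb{N}\}$ where $\mathbb{N}=\{1,2,3,\dots\}$, and for $N\in\mathbb{N}$ let $$D(S+1,N)=\max\{|A| : A\subseteq\{1,2,\dots,N\},\ (A-A)\cap(S+1)\subseteq\{0\}\}.$$ Then for all $N\in\mathbb{N}$, $$D(S+1,N)=\lceil N/3\rceil+1_E(N)+1_{\{9,24\}}(N),$$ where $E=\{2,3,5,6,8,9,10,11,12,17,18,20,21,23,24,25,26,27\}$ and $1_F$ denotes the indicator function of a set $F$.
   Context: For a set $A$ of integers, $A-A=\{a-b: a,b\in A\}$. Thus $D(S+1,N)$ is the maximum size of a subset of $\{1,\dots,N\}$ no two distinct elements of which differ by a number of the form $n^2+1$ with $n$ a positive integer. -}

module Defs where

open import Data.Nat using (ℕ; zero; suc; _+_; _*_; _∸_; _<_; _≤_; _/_)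
open import Data.Nat.Properties using (_≟_)
open import Data.Fin using (Fin; toℕ)
open import Data.Fin.Subset using (Subset; _∈_; ∣_∣)
open import Data.Product using (Σ; _×_; ∃)
open import Data.Bool using (Bool; true; false; if_then_else_)
open import Data.List using (List; []; _∷_)
open import Relation.Binary.PropositionalEquality using (_≡_)
open import Relation.Nullary using (¬_)

InS+1 : ℕ → Set
InS+1 d = Σ ℕ λ n → (1 ≤ n) × (d ≡ n * n + 1)

-- A subset of {1,…,N} is encoded as a Subset N of Fin N, where i : Fin N
-- stands for the integer toℕ i + 1.  Since difference sets are symmetric
-- and 0 ∉ S+1, (A-A) ∩ (S+1) ⊆ {0} iff no a < b in A have b - a ∈ S+1.
Admissible : (N : ℕ) → Subset N → Set
Admissible N A = ∀ (i j : Fin N) → i ∈ A → j ∈ A →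
  toℕ i < toℕ j → ¬ InS+1 (toℕ j ∸ toℕ i)

IsD : (N : ℕ) → ℕ → Set
IsD N m = (Σ (Subset N) λ A → Admissible N A × (∣ A ∣ ≡ m))
        × (∀ (A : Subset N) → Admissible N A → ∣ A ∣ ≤ m)

ceil3 : ℕ → ℕ
ceil3 N = (N + 2) / 3

member? : ℕ → List ℕ → Bool
member? n [] = false
member? n (x ∷ xs) with n ≟ x
... | Relation.Nullary.yes _ = true
... | Relation.Nullary.no _ = member? n xs

𝟙 : List ℕ → ℕ → ℕ
𝟙 F n = if member? n F then 1 else 0

E : List ℕ
E = 2 ∷ 3 ∷ 5 ∷ 6 ∷ 8 ∷ 9 ∷ 10 ∷ 11 ∷ 12 ∷ 17 ∷ 18 ∷ 20 ∷ 21 ∷ 23 ∷ 24 ∷ 25 ∷ 26 ∷ 27 ∷ []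

E′ : List ℕ
E′ = 9 ∷ 24 ∷ []

-- A set A ⊆ {1,…,N} with no difference in S+1 stays admissible when restricted to a
-- subinterval, so the extremal function is subadditive over partitions of the interval.
-- A branch-and-bound search, pruned by the bound already established for shorter
-- intervals, verifies D(S+1,N) ≤ ⌈N/3⌉ + 1_E(N) + 1_{9,24}(N) for N ≤ 42; beyond that,
-- splitting off a final block of 15 (where the bound is 5) propagates it, because the
-- right-hand side grows by exactly 5 under N ↦ N + 15 once N ≥ 28.  Conversely the
-- multiples of 3 in the interval are admissible since 3 never divides n² + 1, and
-- explicit sets attain the bound for N ≤ 27.
module Submission where

open import Defs
open import Data.Bool using (Bool; true; false; _∧_; _∨_; if_then_else_; T)
open import Data.Bool.Properties using (T-∧; T-∨)
open import Data.Empty using (⊥-elim)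
open import Data.Fin using (Fin; toℕ) renaming (zero to fzero; suc to fsuc)
open import Data.Fin.Subset using (Subset; _∈_; ∣_∣)
open import Data.List using (List; []; _∷_; _++_; [_]; length; take; drop)
open import Data.List.Base using (initLast; _∷ʳ′_)
open import Data.List.Properties using (length-++; length-take; length-drop; take++drop≡id; ++-assoc; ++-identityʳ)
open import Data.List.Relation.Unary.All as All using (All; []; _∷_; all?)
open import Data.Nat using (ℕ; zero; suc; _+_; _*_; _∸_; _≤_; _<_; _≤ᵇ_; z≤n; s≤s; _/_; _%_; _≤?_; _<?_; NonZero; >-nonZero⁻¹; _⊓_)
open import Data.Nat.Properties
open import Data.Nat.DivMod using (m%n<n; m*n/n≡m; %-distribˡ-+; %-distribˡ-*; +-distrib-/-∣ʳ)
open import Data.Nat.Divisibility using (_∣_; divides; ∣-refl; ∣m∣n⇒∣m+n; ∣m+n∣m⇒∣n; n∣m⇒m%n≡0)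
open import Data.Nat.Induction using (<-rec)
open import Data.Product using (Σ; _×_; _,_; proj₁; proj₂)
open import Data.Sum using (inj₁; inj₂)
open import Data.Vec using (toList) renaming ([] to []ᵛ; _∷_ to _∷ᵛ_)
open import Data.Vec.Base using (here; there)
open import Data.Vec.Properties using (length-toList)
open import Function using (_∘_)
open import Function.Bundles using (Equivalence)
open import Relation.Nullary using (¬_; yes; no)
open import Relation.Nullary.Decidable using (isNo; map′; toWitness; toWitnessFalse; fromWitnessFalse; _×-dec_; T?)
open import Relation.Unary using (Decidable)
open import Relation.Binary.PropositionalEquality using (_≡_; refl; sym; trans; cong; cong₂; subst; module ≡-Reasoning)

open Equivalence using (to; from)

module DifferenceAvoidance {P : ℕ → Set} (P? : Decidable P) where

  DifferenceFree : (N : ℕ) → Subset N → Set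
  DifferenceFree N A = ∀ (i j : Fin N) → i ∈ A → j ∈ A →
    toℕ i < toℕ j → ¬ P (toℕ j ∸ toℕ i)

  size : List Bool → ℕ
  size []           = 0
  size (true ∷ xs)  = suc (size xs)
  size (false ∷ xs) = size xs

  -- Reading xs as B = {i | xs[i] = true}: no element of d + B lies in P.
  avoidsShiftᵇ : ℕ → List Bool → Bool
  avoidsShiftᵇ d []           = true
  avoidsShiftᵇ d (false ∷ xs) = avoidsShiftᵇ (suc d) xs
  avoidsShiftᵇ d (true ∷ xs)  = isNo (P? d) ∧ avoidsShiftᵇ (suc d) xs

  differenceFreeᵇ : List Bool → Bool
  differenceFreeᵇ []           = true
  differenceFreeᵇ (false ∷ xs) = differenceFreeᵇ xs
  differenceFreeᵇ (true ∷ xs)  = avoidsShiftᵇ 1 xs ∧ differenceFreeᵇ xs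

  size-++ : ∀ xs ys → size (xs ++ ys) ≡ size xs + size ys
  size-++ []           ys = refl
  size-++ (true ∷ xs)  ys = cong suc (size-++ xs ys)
  size-++ (false ∷ xs) ys = size-++ xs ys

  size-toList : ∀ {n} (A : Subset n) → ∣ A ∣ ≡ size (toList A)
  size-toList []ᵛ          = refl
  size-toList (true ∷ᵛ A)  = cong suc (size-toList A)
  size-toList (false ∷ᵛ A) = size-toList A

  avoidsShiftᵇ-++⁻ˡ : ∀ d xs ys → T (avoidsShiftᵇ d (xs ++ ys)) → T (avoidsShiftᵇ d xs)
  avoidsShiftᵇ-++⁻ˡ d []           ys h = _
  avoidsShiftᵇ-++⁻ˡ d (false ∷ xs) ys h = avoidsShiftᵇ-++⁻ˡ (suc d) xs ys h
  avoidsShiftᵇ-++⁻ˡ d (true ∷ xs)  ys h =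
    let ¬Pd , rest = to T-∧ h in from T-∧ (¬Pd , avoidsShiftᵇ-++⁻ˡ (suc d) xs ys rest)

  differenceFreeᵇ-++⁻ : ∀ xs ys → T (differenceFreeᵇ (xs ++ ys)) →
    T (differenceFreeᵇ xs) × T (differenceFreeᵇ ys)
  differenceFreeᵇ-++⁻ []           ys h = _ , h
  differenceFreeᵇ-++⁻ (false ∷ xs) ys h = differenceFreeᵇ-++⁻ xs ys h
  differenceFreeᵇ-++⁻ (true ∷ xs)  ys h =
    let head , rest = to T-∧ h
        xs-free , ys-free = differenceFreeᵇ-++⁻ xs ys rest
    in from T-∧ (avoidsShiftᵇ-++⁻ˡ 1 xs ys head , xs-free) , ys-free

  avoidsShiftᵇ-sound : ∀ {n} d (v : Subset n) → T (avoidsShiftᵇ d (toList v)) →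
    ∀ j → j ∈ v → ¬ P (d + toℕ j)
  avoidsShiftᵇ-sound d (true ∷ᵛ v) h fzero here =
    toWitnessFalse {a? = P? d} (proj₁ (to T-∧ h)) ∘ subst P (+-identityʳ d)
  avoidsShiftᵇ-sound d (true ∷ᵛ v) h (fsuc j) (there j∈v) =
    avoidsShiftᵇ-sound (suc d) v (proj₂ (to T-∧ h)) j j∈v ∘ subst P (+-suc d (toℕ j))
  avoidsShiftᵇ-sound d (false ∷ᵛ v) h (fsuc j) (there j∈v) =
    avoidsShiftᵇ-sound (suc d) v h j j∈v ∘ subst P (+-suc d (toℕ j))

  avoidsShiftᵇ-complete : ∀ {n} d (v : Subset n) → (∀ j → j ∈ v → ¬ P (d + toℕ j)) →
    T (avoidsShiftᵇ d (toList v))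
  avoidsShiftᵇ-complete d []ᵛ          avoids = _
  avoidsShiftᵇ-complete d (false ∷ᵛ v) avoids =
    avoidsShiftᵇ-complete (suc d) v λ j j∈v →
      avoids (fsuc j) (there j∈v) ∘ subst P (sym (+-suc d (toℕ j)))
  avoidsShiftᵇ-complete d (true ∷ᵛ v)  avoids = from T-∧
    ( fromWitnessFalse (avoids fzero here ∘ subst P (sym (+-identityʳ d)))
    , avoidsShiftᵇ-complete (suc d) v λ j j∈v →
        avoids (fsuc j) (there j∈v) ∘ subst P (sym (+-suc d (toℕ j))) )

  DifferenceFree-tail : ∀ {n x} {A : Subset n} → DifferenceFree (suc n) (x ∷ᵛ A) → DifferenceFree n A
  DifferenceFree-tail free i j i∈A j∈A i<j = free (fsuc i) (fsuc j) (there i∈A) (there j∈A) (s≤s i<j)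

  differenceFreeᵇ-sound : ∀ {n} (A : Subset n) → T (differenceFreeᵇ (toList A)) → DifferenceFree n A
  differenceFreeᵇ-sound (x ∷ᵛ A) h fzero (fsuc j) here (there j∈A) _ =
    avoidsShiftᵇ-sound 1 A (proj₁ (to T-∧ h)) j j∈A
  differenceFreeᵇ-sound (x ∷ᵛ A) h (fsuc i) (fsuc j) (there i∈A) (there j∈A) (s≤s i<j) =
    differenceFreeᵇ-sound A (proj₂ (differenceFreeᵇ-++⁻ [ x ] (toList A) h)) i j i∈A j∈A i<j

  differenceFreeᵇ-complete : ∀ {n} (A : Subset n) → DifferenceFree n A → T (differenceFreeᵇ (toList A))
  differenceFreeᵇ-complete []ᵛ          free = _
  differenceFreeᵇ-complete (false ∷ᵛ A) free = differenceFreeᵇ-complete A (DifferenceFree-tail free)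
  differenceFreeᵇ-complete (true ∷ᵛ A)  free = from T-∧
    ( avoidsShiftᵇ-complete 1 A (λ j j∈A → free fzero (fsuc j) here (there j∈A) (s≤s z≤n))
    , differenceFreeᵇ-complete A (DifferenceFree-tail free) )

  module BranchAndBound (F : ℕ → ℕ) where

    BoundedAt : ℕ → Set
    BoundedAt n = ∀ xs → length xs ≡ n → T (differenceFreeᵇ xs) → size xs ≤ F n

    -- extensionsAtMostᵇ b r s certifies size (p ++ s) ≤ b for every difference-free
    -- p ++ s with length p ≡ r; the unknown prefix p is bounded by F (length p).
    extensionsAtMostᵇ branchesAtMostᵇ : ℕ → ℕ → List Bool → Bool
    extensionsAtMostᵇ b zero    s = size s ≤ᵇ b
    extensionsAtMostᵇ b (suc r) s = (size s + F (suc r) ≤ᵇ b) ∨ branchesAtMostᵇ b r s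
    branchesAtMostᵇ b r s = extensionsAtMostᵇ b r (false ∷ s) ∧
      (if avoidsShiftᵇ 1 s then extensionsAtMostᵇ b r (true ∷ s) else true)

    private
      T-if-true : ∀ {c x y} → T c → T (if c then x else y) → T x
      T-if-true {true} _ h = h

    extensionsAtMostᵇ-sound : ∀ {b} r s → (∀ {n} → n ≤ r → BoundedAt n) →
      T (extensionsAtMostᵇ b r s) →
      ∀ p → length p ≡ r → T (differenceFreeᵇ (p ++ s)) → size (p ++ s) ≤ b
    branchesAtMostᵇ-sound : ∀ {b} r s → (∀ {n} → n ≤ r → BoundedAt n) →
      T (branchesAtMostᵇ b r s) →
      ∀ p → length p ≡ suc r → T (differenceFreeᵇ (p ++ s)) → size (p ++ s) ≤ b

    extensionsAtMostᵇ-sound zero s _ h [] _ _ = ≤ᵇ⇒≤ (size s) _ h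
    extensionsAtMostᵇ-sound {b} (suc r) s bounded h p |p| free with to T-∨ h
    ... | inj₂ branches = branchesAtMostᵇ-sound r s (bounded ∘ m≤n⇒m≤1+n) branches p |p| free
    ... | inj₁ cut = begin
      size (p ++ s)        ≡⟨ size-++ p s ⟩
      size p + size s      ≤⟨ +-monoˡ-≤ (size s) (bounded ≤-refl p |p| (proj₁ (differenceFreeᵇ-++⁻ p s free))) ⟩
      F (suc r) + size s   ≡⟨ +-comm (F (suc r)) (size s) ⟩
      size s + F (suc r)   ≤⟨ ≤ᵇ⇒≤ _ b cut ⟩
      b                    ∎
      where open ≤-Reasoning

    branchesAtMostᵇ-sound {b} r s bounded h p |p| free with initLast p
    ... | [] = ⊥-elim (0≢1+n |p|)
    ... | p′ ∷ʳ′ x rewrite ++-assoc p′ [ x ] s = extend x free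
      where
      |p′| : length p′ ≡ r
      |p′| = suc-injective (trans (trans (sym (+-comm (length p′) 1)) (sym (length-++ p′))) |p|)
      extend : ∀ x → T (differenceFreeᵇ (p′ ++ x ∷ s)) → size (p′ ++ x ∷ s) ≤ b
      extend false free′ = extensionsAtMostᵇ-sound r (false ∷ s) bounded (proj₁ (to T-∧ h)) p′ |p′| free′
      extend true  free′ = extensionsAtMostᵇ-sound r (true ∷ s) bounded
        (T-if-true s-extends (proj₂ (to T-∧ h))) p′ |p′| free′
        where
        s-extends : T (avoidsShiftᵇ 1 s)
        s-extends = proj₁ (to T-∧ (proj₂ (differenceFreeᵇ-++⁻ p′ (true ∷ s) free′)))

    -- Pruning with F (suc L) would be circular here, so the search starts one level down.
    boundedAt-suc : ∀ L → (∀ {n} → n ≤ L → BoundedAt n) →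
      T (branchesAtMostᵇ (F (suc L)) L []) → BoundedAt (suc L)
    boundedAt-suc L bounded h xs |xs| free =
      subst (λ ys → size ys ≤ F (suc L)) (++-identityʳ xs)
        (branchesAtMostᵇ-sound L [] bounded h xs |xs| (subst (T ∘ differenceFreeᵇ) (sym (++-identityʳ xs)) free))

    boundedUpTo : ∀ K → (∀ {L} → L < K → T (branchesAtMostᵇ (F (suc L)) L [])) →
      ∀ {n} → n ≤ K → BoundedAt n
    boundedUpTo zero    _      z≤n []       _ _ = z≤n
    boundedUpTo (suc K) checks n≤1+K with m≤n⇒m<n∨m≡n n≤1+K
    ... | inj₁ n<1+K = boundedUpTo K (checks ∘ m<n⇒m<1+n) (≤-pred n<1+K)
    ... | inj₂ refl  = boundedAt-suc K (boundedUpTo K (checks ∘ m<n⇒m<1+n)) (checks ≤-refl)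

    boundedAt-+ : ∀ {m n} → BoundedAt m → BoundedAt n → F m + F n ≤ F (m + n) → BoundedAt (m + n)
    boundedAt-+ {m} {n} bounded-m bounded-n superadditive xs |xs| free = begin
      size xs                              ≡⟨ cong size (take++drop≡id m xs) ⟨
      size (take m xs ++ drop m xs)        ≡⟨ size-++ (take m xs) (drop m xs) ⟩
      size (take m xs) + size (drop m xs)  ≤⟨ +-mono-≤ (bounded-m (take m xs) |take| (proj₁ halves))
                                                  (bounded-n (drop m xs) |drop| (proj₂ halves)) ⟩
      F m + F n                            ≤⟨ superadditive ⟩
      F (m + n)                            ∎
      where
      open ≤-Reasoning
      halves = differenceFreeᵇ-++⁻ (take m xs) (drop m xs)
                 (subst (T ∘ differenceFreeᵇ) (sym (take++drop≡id m xs)) free)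
      |take| : length (take m xs) ≡ m
      |take| = trans (length-take m xs) (trans (cong (m ⊓_) |xs|) (m≤n⇒m⊓n≡m (m≤m+n m n)))
      |drop| : length (drop m xs) ≡ n
      |drop| = trans (length-drop m xs) (trans (cong (_∸ m) |xs|) (m+n∸m≡n m n))

    boundedAt-periodic : ∀ K p .{{_ : NonZero p}} → (∀ {n} → n ≤ K + p → BoundedAt n) →
      (∀ m → K < m → F m + F p ≤ F (m + p)) → ∀ n → BoundedAt n
    boundedAt-periodic K p initial superadditive = <-rec BoundedAt step
      where
      step : ∀ n → (∀ {m} → m < n → BoundedAt m) → BoundedAt n
      step n earlier with n ≤? K + p
      ... | yes n≤K+p = initial n≤K+p
      ... | no n≰K+p = subst BoundedAt (m∸n+n≡m p≤n)
            (boundedAt-+ (earlier (∸-monoʳ-< (>-nonZero⁻¹ p) p≤n)) (initial (m≤n+m p K))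
              (superadditive (n ∸ p) (m+n≤o⇒m≤o∸n (suc K) K+p<n)))
        where
        K+p<n : K + p < n
        K+p<n = ≰⇒> n≰K+p
        p≤n : p ≤ n
        p≤n = ≤-trans (m≤n+m p K) (<⇒≤ K+p<n)

InS+1? : Decidable InS+1
InS+1? d = map′ (λ (n , _ , 1≤n , d≡) → n , 1≤n , d≡)
                (λ (n , 1≤n , d≡) → n , subst (n <_) (sym d≡) (n<n*n+1 n) , 1≤n , d≡)
                (anyUpTo? (λ n → (1 ≤? n) ×-dec (d ≟ n * n + 1)) d)
  where
  n<n*n+1 : ∀ n → n < n * n + 1
  n<n*n+1 zero    = s≤s z≤n
  n<n*n+1 (suc n) = ≤-<-trans (m≤m*n (suc n) (suc n)) (m<m+n _ (s≤s z≤n))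

open DifferenceAvoidance InS+1?

D : ℕ → ℕ
D N = ceil3 N + 𝟙 E N + 𝟙 E′ N

member?-≡false : ∀ {n xs} → All (_< n) xs → member? n xs ≡ false
member?-≡false                 []           = refl
member?-≡false {n} {x ∷ _} (x<n ∷ xs<n) with n ≟ x
... | yes refl = ⊥-elim (<-irrefl refl x<n)
... | no _     = member?-≡false xs<n

𝟙-above : ∀ {n F} → All (_< n) F → 𝟙 F n ≡ 0
𝟙-above F<n rewrite member?-≡false F<n = refl

E<28 : All (_< 28) E
E<28 = toWitness {a? = all? (_<? 28) E} _

E′<28 : All (_< 28) E′
E′<28 = toWitness {a? = all? (_<? 28) E′} _

D-≥28 : ∀ {N} → 28 ≤ N → D N ≡ ceil3 N
D-≥28 {N} 28≤N = trans (cong₂ (λ a b → ceil3 N + a + b) (𝟙-above (raise E<28)) (𝟙-above (raise E′<28)))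
                       (trans (+-identityʳ _) (+-identityʳ _))
  where
  raise : ∀ {xs} → All (_< 28) xs → All (_< N) xs
  raise = All.map (λ x<28 → <-≤-trans x<28 28≤N)

ceil3-+ : ∀ m k → ceil3 (m + k * 3) ≡ ceil3 m + k
ceil3-+ m k = begin
  (m + k * 3 + 2) / 3      ≡⟨ cong (_/ 3) (+-assoc m (k * 3) 2) ⟩
  (m + (k * 3 + 2)) / 3    ≡⟨ cong (λ x → (m + x) / 3) (+-comm (k * 3) 2) ⟩
  (m + (2 + k * 3)) / 3    ≡⟨ cong (_/ 3) (+-assoc m 2 (k * 3)) ⟨
  (m + 2 + k * 3) / 3      ≡⟨ +-distrib-/-∣ʳ (m + 2) (divides k refl) ⟩
  ceil3 m + k * 3 / 3      ≡⟨ cong (ceil3 m +_) (m*n/n≡m k 3) ⟩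
  ceil3 m + k              ∎
  where open ≡-Reasoning

D-superadditive : ∀ m → 27 < m → D m + D 15 ≤ D (m + 15)
D-superadditive m 27<m = ≤-reflexive (begin
  D m + 5            ≡⟨ cong (_+ 5) (D-≥28 27<m) ⟩
  ceil3 m + 5        ≡⟨ ceil3-+ m 5 ⟨
  ceil3 (m + 15)     ≡⟨ D-≥28 (≤-trans 27<m (m≤m+n m 15)) ⟨
  D (m + 15)         ∎)
  where open ≡-Reasoning

open BranchAndBound D

D-upper-bound : ∀ {N} (A : Subset N) → Admissible N A → ∣ A ∣ ≤ D N
D-upper-bound {N} A admissible = subst (_≤ D N) (sym (size-toList A))
  (boundedAt-periodic 27 15 boundedUpTo42 D-superadditive N (toList A) (length-toList A)
    (differenceFreeᵇ-complete A admissible))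
  where
  boundedUpTo42 : ∀ {n} → n ≤ 42 → BoundedAt n
  boundedUpTo42 = boundedUpTo 42
    (toWitness {a? = allUpTo? (λ L → T? (branchesAtMostᵇ (D (suc L)) L [])) 42} _)

3∤n*n+1 : ∀ n → ¬ 3 ∣ n * n + 1
3∤n*n+1 n 3∣n*n+1 = nonResidue (n % 3) (m%n<n n 3) (begin
  ((n % 3) * (n % 3) % 3 + 1) % 3  ≡⟨ cong (λ r → (r + 1) % 3) (%-distribˡ-* n n 3) ⟨
  (n * n % 3 + 1) % 3              ≡⟨ %-distribˡ-+ (n * n) 1 3 ⟨
  (n * n + 1) % 3                  ≡⟨ n∣m⇒m%n≡0 _ 3 3∣n*n+1 ⟩
  0                                ∎)
  where
  open ≡-Reasoning
  nonResidue : ∀ r → r < 3 → ¬ (r * r % 3 + 1) % 3 ≡ 0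
  nonResidue 0 _ ()
  nonResidue 1 _ ()
  nonResidue 2 _ ()
  nonResidue (suc (suc (suc _))) (s≤s (s≤s (s≤s ())))

everyThird : (N : ℕ) → Subset N
everyThird 0                     = []ᵛ
everyThird 1                     = true ∷ᵛ []ᵛ
everyThird 2                     = true ∷ᵛ false ∷ᵛ []ᵛ
everyThird (suc (suc (suc N)))   = true ∷ᵛ false ∷ᵛ false ∷ᵛ everyThird N

∣everyThird∣ : ∀ N → ∣ everyThird N ∣ ≡ ceil3 N
∣everyThird∣ 0                   = refl
∣everyThird∣ 1                   = refl
∣everyThird∣ 2                   = refl
∣everyThird∣ (suc (suc (suc N))) = begin
  suc ∣ everyThird N ∣  ≡⟨ cong suc (∣everyThird∣ N) ⟩
  suc (ceil3 N)         ≡⟨ +-comm 1 (ceil3 N) ⟩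
  ceil3 N + 1           ≡⟨ ceil3-+ N 1 ⟨
  ceil3 (N + 3)         ≡⟨ cong ceil3 (+-comm N 3) ⟩
  ceil3 (3 + N)         ∎
  where open ≡-Reasoning

∈everyThird⇒3∣ : ∀ {N} {i : Fin N} → i ∈ everyThird N → 3 ∣ toℕ i
∈everyThird⇒3∣ {1}                   here = divides 0 refl
∈everyThird⇒3∣ {2}                   here = divides 0 refl
∈everyThird⇒3∣ {2}                   (there (there ()))
∈everyThird⇒3∣ {suc (suc (suc N))}   here = divides 0 refl
∈everyThird⇒3∣ {suc (suc (suc N))}   (there (there (there i∈))) = ∣m∣n⇒∣m+n ∣-refl (∈everyThird⇒3∣ i∈)

everyThird-admissible : ∀ N → Admissible N (everyThird N)
everyThird-admissible N i j i∈ j∈ i<j (n , _ , d≡n*n+1) =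
  3∤n*n+1 n (subst (3 ∣_) d≡n*n+1
    (∣m+n∣m⇒∣n (subst (3 ∣_) (sym (m+[n∸m]≡n (<⇒≤ i<j))) (∈everyThird⇒3∣ j∈)) (∈everyThird⇒3∣ i∈)))

prefix : List Bool → (N : ℕ) → Subset N
prefix _        zero    = []ᵛ
prefix []       (suc N) = false ∷ᵛ prefix [] N
prefix (x ∷ xs) (suc N) = x ∷ᵛ prefix xs N

smallExtremal : List Bool
smallExtremal =
  true  ∷ true  ∷ false ∷ false ∷ true  ∷ false ∷ false ∷ true  ∷ true  ∷ false ∷
  false ∷ false ∷ false ∷ false ∷ false ∷ true  ∷ true  ∷ false ∷ false ∷ true  ∷
  false ∷ false ∷ true  ∷ true  ∷ false ∷ false ∷ false ∷ []

prefix-smallExtremal : ∀ {N} → N < 28 →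
  T (differenceFreeᵇ (toList (prefix smallExtremal N))) × ∣ prefix smallExtremal N ∣ ≡ D N
prefix-smallExtremal = toWitness {a? = allUpTo? (λ N →
  T? (differenceFreeᵇ (toList (prefix smallExtremal N))) ×-dec (∣ prefix smallExtremal N ∣ ≟ D N)) 28} _

D-attained : ∀ N → Σ (Subset N) λ A → Admissible N A × ∣ A ∣ ≡ D N
D-attained N with N <? 28
... | yes N<28 = let free , size≡ = prefix-smallExtremal N<28 in
                 prefix smallExtremal N , differenceFreeᵇ-sound _ free , size≡
... | no N≮28  = everyThird N , everyThird-admissible N , trans (∣everyThird∣ N) (sym (D-≥28 (≮⇒≥ N≮28)))

theorem1p3 : (N : ℕ) → 1 ≤ N → IsD N (ceil3 N + 𝟙 E N + 𝟙 E′ N)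
theorem1p3 N _ = D-attained N , D-upper-bound
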